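{- For any integer partition $\lambda$, there exists a $\mathsf{TOTO}$ sentence $\phi$ such that for every permutation $\sigma$, $\sigma\models\phi$ if and only if $\sigma$ has cycle-type $\lambda\cup(1^k)$ for some integer $k\ge0$.
   Context: A permutation $\sigma$ of size $n$ is identified with the finite structure whose domain is $A^\sigma=\{(i,\sigma(i)) : 1\le i\le n\}$, with position order $<_P$ (comparing first coordinates) and value order $<_V$ (comparing second coordinates); $\mathsf{TOTO}$ is first-order logic (with equality) over the signature of two binary relation symbols $<_P,<_V$. The cycle-type of $\sigma$ is the integer partition (multiset of positive integers) of cycle lengths of $\sigma$ as a bijection of $\{1,\dots,n\}$, fixed points counting as cycles of length $1$. For partitions, $(1^k)$ denotes the partition consisting of $k$ parts equal to $1$, and $\lambda\cup\mu$ denotes the multiset union. -}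

module Defs where

open import Data.Nat.Base using (ℕ; zero; suc; _≤ᵇ_)
open import Data.Fin.Base using (Fin; toℕ; _<_)
open import Data.Fin.Properties using (_≟_)
open import Data.Fin.Permutation using (Permutation′; _⟨$⟩ʳ_)
open import Data.Bool.Base using (Bool; true; false; if_then_else_; _∧_)
open import Data.List.Base using (List; map; filterᵇ; foldr; upTo; allFin)
open import Data.Product.Base using (Σ; _×_)
open import Data.Sum.Base using (_⊎_)
open import Data.Empty using (⊥)
open import Relation.Nullary using (¬_; does)
open import Relation.Binary.PropositionalEquality using (_≡_)

-- TOTO: first-order logic with equality over two binary relation
-- symbols <_P and <_V.  Formulas with m free variables (de Bruijn
-- indices in Fin m); a sentence has no free variables.

data Formula (m : ℕ) : Set where
  _<P_ : Fin m → Fin m → Formula m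
  _<V_ : Fin m → Fin m → Formula m
  _≐_  : Fin m → Fin m → Formula m
  ⊥f   : Formula m
  ¬f_  : Formula m → Formula m
  _∧f_ : Formula m → Formula m → Formula m
  _∨f_ : Formula m → Formula m → Formula m
  _⇒f_ : Formula m → Formula m → Formula m
  ∀f   : Formula (suc m) → Formula m
  ∃f   : Formula (suc m) → Formula m

Sentence : Set
Sentence = Formula 0

_▸_ : ∀ {n m} → (Fin m → Fin n) → Fin n → Fin (suc m) → Fin n
(ρ ▸ a) Fin.zero    = a
(ρ ▸ a) (Fin.suc j) = ρ j

-- The domain point
-- (i, σ(i)) is represented by its position i : Fin n; then
--   (i,σ i) <_P (j,σ j)  iff  i < j,
--   (i,σ i) <_V (j,σ j)  iff  σ i < σ j.

⟦_⟧ : ∀ {n m} → Formula m → Permutation′ n → (Fin m → Fin n) → Set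
⟦ x <P y ⟧ σ ρ = ρ x < ρ y
⟦ x <V y ⟧ σ ρ = (σ ⟨$⟩ʳ ρ x) < (σ ⟨$⟩ʳ ρ y)
⟦ x ≐ y ⟧ σ ρ = ρ x ≡ ρ y
⟦ ⊥f ⟧ σ ρ = ⊥
⟦ ¬f φ ⟧ σ ρ = ¬ ⟦ φ ⟧ σ ρ
⟦ φ ∧f ψ ⟧ σ ρ = ⟦ φ ⟧ σ ρ × ⟦ ψ ⟧ σ ρ
⟦ φ ∨f ψ ⟧ σ ρ = ⟦ φ ⟧ σ ρ ⊎ ⟦ ψ ⟧ σ ρ
⟦ φ ⇒f ψ ⟧ σ ρ = ⟦ φ ⟧ σ ρ → ⟦ ψ ⟧ σ ρ
⟦ ∀f φ ⟧ σ ρ = ∀ a → ⟦ φ ⟧ σ (ρ ▸ a)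
⟦ ∃f φ ⟧ σ ρ = Σ _ λ a → ⟦ φ ⟧ σ (ρ ▸ a)

_⊨_ : ∀ {n} → Permutation′ n → Sentence → Set
σ ⊨ φ = ⟦ φ ⟧ σ (λ ())

iter : ∀ {n} → Permutation′ n → ℕ → Fin n → Fin n
iter σ zero    i = i
iter σ (suc k) i = σ ⟨$⟩ʳ iter σ k i

-- Least k ≥ 1 with σ^k(i) = i, found by searching k = 1, 2, …, n
-- (such k ≤ n always exists; the fallback value is never reached).
cycleLenFrom : ∀ {n} → Permutation′ n → Fin n → (k fuel : ℕ) → ℕ
cycleLenFrom σ i k zero       = k
cycleLenFrom σ i k (suc fuel) =
  if does (iter σ k i ≟ i) then k else cycleLenFrom σ i (suc k) fuel

cycleLen : ∀ {n} → Permutation′ n → Fin n → ℕ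
cycleLen {n} σ i = cycleLenFrom σ i 1 n

-- i is the least element of its cycle (each cycle has exactly one such
-- representative).
isCycleMin : ∀ {n} → Permutation′ n → Fin n → Bool
isCycleMin {n} σ i = foldr (λ k b → (toℕ i ≤ᵇ toℕ (iter σ k i)) ∧ b) true (upTo n)

-- The cycle type of σ: the multiset (a list, considered up to
-- permutation) of cycle lengths, one entry per cycle, fixed points
-- contributing 1.
cycleType : ∀ {n} → Permutation′ n → List ℕ
cycleType σ = map (cycleLen σ) (filterᵇ (isCycleMin σ) (allFin _))

-- Write m = λ₁ + λ₂ + ⋯ and let t be the permutation of {1, …, m} that cyclically rotates
-- consecutive blocks of lengths λ₁, λ₂, ….  A permutation σ has cycle type λ ∪ (1ᵏ) exactly
-- when there are distinct points x₁, …, x_m with σ(x_i) = x_{t(i)} for all i and σ fixing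
-- every other point.  That condition is first-order: let f send x_i to x_{t(i)} and fix the
-- remaining points; f = σ iff σ(a) < σ(b) implies f(a) < f(b), because then f ∘ σ⁻¹ is a
-- strictly increasing self-map of {1, …, n}, hence the identity.  In TOTO the premise is
-- a <_V b and the conclusion f(a) <_P f(b), and the graph of f is definable from x₁, …, x_m.
--
-- On the cycle-type side, any list of pairs (start point, least period) whose orbits
-- partition the domain has the cycle type as its list of periods: sending each pair to the
-- minimum of its cycle matches it bijectively with the cycle minima that cycleType ranges over.

module Submission where

open import Defs
open import Data.Bool.Base using (Bool; true; T; _∧_; if_then_else_)
open import Data.Empty using (⊥-elim)
open import Data.Fin using (#_)
open import Data.Fin.Base using (Fin; zero; suc; toℕ; fromℕ<; inject₁; _<_; _↑ˡ_; _↑ʳ_; splitAt; opposite)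
open import Data.Fin.Induction using (<-weakInduction)
open import Data.Fin.Permutation using (Permutation′; _⟨$⟩ʳ_; _⟨$⟩ˡ_; inverseˡ; inverseʳ)
open import Data.Fin.Properties as Finₚ using (any?; pigeonhole; toℕ-injective; toℕ<n; toℕ-fromℕ<; fromℕ<-toℕ; toℕ-inject₁; ≤̄⇒inject₁<; opposite-prop; opposite-involutive)
open import Data.List.Base using (List; []; _∷_; _++_; map; concatMap; tabulate; allFin; upTo; foldr; filter; filterᵇ; replicate; length)
open import Data.List.Extrema.Nat using (argmin; f[argmin]≤f[xs]; argmin-sel)
open import Data.List.Membership.Propositional using (_∈_)
open import Data.List.Membership.Propositional.Properties using (∈-tabulate⁺; ∈-tabulate⁻; ∈-allFin; ∈-upTo⁺; ∈-filter⁺; ∈-filter⁻; ∈-map⁺; ∈-map⁻; ∈-++⁺ˡ; ∈-++⁺ʳ; ∈-++⁻)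
open import Data.List.Membership.Propositional.Properties.WithK using (unique∧set⇒bag)
open import Data.List.Properties using (foldr-map; map-∘; map-++; tabulate-cong; concatMap-++; ∷-injective)
open import Data.List.Relation.Binary.BagAndSetEquality using (∼bag⇒↭)
open import Data.List.Relation.Binary.Disjoint.Propositional using (Disjoint)
open import Data.List.Relation.Binary.Permutation.Propositional as ↭ using (_↭_; ↭-refl; ↭-sym; ↭-trans; ↭⇒↭ₛ; module PermutationReasoning)
import Data.List.Relation.Binary.Permutation.Propositional.Properties as ↭ₚ
import Data.List.Relation.Binary.Permutation.Setoid.Properties as ↭ₛₚ
open import Data.List.Relation.Unary.All as All using (All; []; _∷_)
open import Data.List.Relation.Unary.All.Properties using (all⁺; all⁻; ++⁺; ++⁻ˡ; ++⁻ʳ; map⁺)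
open import Data.List.Relation.Unary.AllPairs using ([]; _∷_)
open import Data.List.Relation.Unary.Any using (here; there)
open import Data.List.Relation.Unary.Unique.Propositional using (Unique)
import Data.List.Relation.Unary.Unique.Propositional.Properties as Uniqueₚ
open import Data.Nat.Base as ℕ using (ℕ; _+_; _*_; _∸_; _≤_; _≤ᵇ_; z≤n; s≤s; NonZero)
open import Data.Nat.DivMod using (_%_; _/_; m≡m%n+[m/n]*n; m%n<n; m<n⇒m%n≡m; n%n≡0)
open import Data.Nat.ListAction using (sum)
import Data.Nat.Properties as ℕₚ
open import Data.Product.Base using (Σ; ∃; ∃₂; _×_; _,_; proj₁; proj₂; uncurry)
open import Data.Sum.Base using (inj₁; inj₂)
import Data.Vec.Functional as V
import Data.Vec.Functional.Properties as V
open import Function.Base using (_∘_; case_of_)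
open import Function.Bundles using (_⇔_; mk⇔; Equivalence; Injection)
open import Function.Definitions using (Injective)
import Function.Properties.Equivalence as ⇔
open import Function.Properties.Inverse using (↔⇒↣)
open import Relation.Binary.Definitions using (tri<; tri≈; tri>)
open import Relation.Binary.PropositionalEquality
open import Relation.Nullary using (¬_; ¬?; yes; no; does)
open import Relation.Nullary.Decidable using (T?)
open import Relation.Unary using (Decidable)

Unique-++⁻ : ∀ {A : Set} (xs : List A) {ys} → Unique (xs ++ ys) → Unique xs × Unique ys × Disjoint xs ys
Unique-++⁻ []       u         = [] , u , λ ()
Unique-++⁻ (x ∷ xs) (x∉ ∷ u) with Unique-++⁻ xs u
... | uxs , uys , xs#ys = ++⁻ˡ xs x∉ ∷ uxs , uys , λ where
  (here refl , x∈ys) → All.lookup (++⁻ʳ xs x∉) x∈ys refl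
  (there v∈xs , v∈ys) → xs#ys (v∈xs , v∈ys)

Unique-⇔⇒↭ : ∀ {A : Set} {xs ys : List A} → Unique xs → Unique ys →
             (∀ {x} → x ∈ xs → x ∈ ys) → (∀ {x} → x ∈ ys → x ∈ xs) → xs ↭ ys
Unique-⇔⇒↭ u v xs⊆ys ys⊆xs = ∼bag⇒↭ (unique∧set⇒bag u v (mk⇔ xs⊆ys ys⊆xs))

map-++⁻ : ∀ {A B : Set} (f : A → B) xs ys zs → map f zs ≡ xs ++ ys →
          ∃₂ λ us vs → zs ≡ us ++ vs × map f us ≡ xs × map f vs ≡ ys
map-++⁻ f []       ys zs       e = [] , zs , refl , refl , e
map-++⁻ f (x ∷ xs) ys (z ∷ zs) e with map-++⁻ f xs ys zs (proj₂ (∷-injective e))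
... | us , vs , refl , refl , refl = z ∷ us , vs , refl , cong (_∷ map f us) (proj₁ (∷-injective e)) , refl

map≡replicate⁻ : ∀ {A B : Set} (f : A → B) {y} k xs → map f xs ≡ replicate k y → All (λ x → f x ≡ y) xs
map≡replicate⁻ f ℕ.zero    []       _ = []
map≡replicate⁻ f (ℕ.suc k) (x ∷ xs) e = proj₁ (∷-injective e) ∷ map≡replicate⁻ f k xs (proj₂ (∷-injective e))

tabulate-split : ∀ {A : Set} m {k} (f : Fin (m + k) → A) →
                 tabulate f ≡ tabulate (f ∘ (_↑ˡ k)) ++ tabulate (f ∘ (m ↑ʳ_))
tabulate-split ℕ.zero    f = refl
tabulate-split (ℕ.suc m) f = cong (f zero ∷_) (tabulate-split m (f ∘ suc))

Unique-tabulate⁻ : ∀ {A : Set} {m} {f : Fin m → A} → Unique (tabulate f) → Injective _≡_ _≡_ f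
Unique-tabulate⁻          (f₀∉ ∷ u) {zero}  {zero}  _ = refl
Unique-tabulate⁻ {f = f} (f₀∉ ∷ u) {zero}  {suc j} e = ⊥-elim (All.lookup f₀∉ (∈-tabulate⁺ {f = f ∘ suc} j) e)
Unique-tabulate⁻ {f = f} (f₀∉ ∷ u) {suc i} {zero}  e = ⊥-elim (All.lookup f₀∉ (∈-tabulate⁺ {f = f ∘ suc} i) (sym e))
Unique-tabulate⁻          (f₀∉ ∷ u) {suc i} {suc j} e = cong suc (Unique-tabulate⁻ u e)

outsideImage? : ∀ {n m} (X : Fin m → Fin n) → Decidable (λ y → ¬ ∃ λ i → X i ≡ y)
outsideImage? X y = ¬? (any? (λ i → X i Finₚ.≟ y))

outsideImage : ∀ {n m} → (Fin m → Fin n) → List (Fin n)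
outsideImage X = filter (outsideImage? X) (allFin _)

∈-outsideImage⁻ : ∀ {n m} {X : Fin m → Fin n} {y} → y ∈ outsideImage X → ∀ i → X i ≢ y
∈-outsideImage⁻ {X = X} y∈ i e = proj₂ (∈-filter⁻ (outsideImage? X) {xs = allFin _} y∈) (i , e)

Unique-tabulate++outsideImage : ∀ {n m} {X : Fin m → Fin n} → Injective _≡_ _≡_ X → Unique (tabulate X ++ outsideImage X)
Unique-tabulate++outsideImage {n} {X = X} injective =
  Uniqueₚ.++⁺ (Uniqueₚ.tabulate⁺ injective) (Uniqueₚ.filter⁺ (outsideImage? X) (Uniqueₚ.allFin⁺ n)) image#outside
  where
    image#outside : Disjoint (tabulate X) (outsideImage X)
    image#outside (x∈ , x∈′) with ∈-tabulate⁻ x∈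
    ... | i , refl = ∈-outsideImage⁻ x∈′ i refl

∈-tabulate++outsideImage : ∀ {n m} {X : Fin m → Fin n} y → y ∈ tabulate X ++ outsideImage X
∈-tabulate++outsideImage {X = X} y with any? (λ i → X i Finₚ.≟ y)
... | yes (i , refl) = ∈-++⁺ˡ (∈-tabulate⁺ i)
... | no  ∉image      = ∈-++⁺ʳ (tabulate X) (∈-filter⁺ (outsideImage? X) (∈-allFin y) ∉image)

increasing⇒inflationary : ∀ {n} (g : Fin n → Fin n) → (∀ {c d} → c < d → g c < g d) → ∀ c → toℕ c ≤ toℕ (g c)
increasing⇒inflationary {ℕ.suc n} g increasing = <-weakInduction (λ c → toℕ c ≤ toℕ (g c)) z≤n step
  where
    step : ∀ i → toℕ (inject₁ i) ≤ toℕ (g (inject₁ i)) → toℕ (suc i) ≤ toℕ (g (suc i))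
    step i ih = ℕₚ.≤-<-trans (subst (_≤ toℕ (g (inject₁ i))) (toℕ-inject₁ i) ih) (increasing (≤̄⇒inject₁< ℕₚ.≤-refl))

opposite-< : ∀ {n} {c d : Fin n} → c < d → opposite d < opposite c
opposite-< {c = c} {d} c<d = subst₂ ℕ._<_ (sym (opposite-prop d)) (sym (opposite-prop c)) (ℕₚ.∸-monoʳ-< (s≤s c<d) (toℕ<n d))

increasing⇒≗id : ∀ {n} (g : Fin n → Fin n) → (∀ {c d} → c < d → g c < g d) → ∀ c → g c ≡ c
increasing⇒≗id g increasing c =
  toℕ-injective (ℕₚ.≤-antisym (ℕₚ.≮⇒≥ not-above) (increasing⇒inflationary g increasing c))
  where
    mirrored : ∀ c → toℕ c ≤ toℕ (opposite (g (opposite c)))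
    mirrored = increasing⇒inflationary (opposite ∘ g ∘ opposite) (opposite-< ∘ increasing ∘ opposite-<)
    not-above : ¬ (c < g c)
    not-above c<gc = ℕₚ.<⇒≱ (opposite-< c<gc)
      (subst (λ x → toℕ (opposite c) ≤ toℕ (opposite (g x))) (opposite-involutive c) (mirrored (opposite c)))

-- Cycles of a permutation

module _ {n : ℕ} (σ : Permutation′ n) where

  iter-+ : ∀ j k a → iter σ (j + k) a ≡ iter σ j (iter σ k a)
  iter-+ ℕ.zero    k a = refl
  iter-+ (ℕ.suc j) k a = cong (σ ⟨$⟩ʳ_) (iter-+ j k a)

  iter-comm : ∀ j k a → iter σ j (iter σ k a) ≡ iter σ k (iter σ j a)
  iter-comm j k a = begin
    iter σ j (iter σ k a) ≡⟨ iter-+ j k a ⟨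
    iter σ (j + k) a      ≡⟨ cong (λ m → iter σ m a) (ℕₚ.+-comm j k) ⟩
    iter σ (k + j) a      ≡⟨ iter-+ k j a ⟩
    iter σ k (iter σ j a) ∎
    where open ≡-Reasoning

  iter-injective : ∀ k → Injective _≡_ _≡_ (iter σ k)
  iter-injective ℕ.zero    e = e
  iter-injective (ℕ.suc k) e = iter-injective k (Injection.injective (↔⇒↣ σ) e)

  iter-* : ∀ {L a} q → iter σ L a ≡ a → iter σ (q * L) a ≡ a
  iter-* {L} {a} ℕ.zero    per = refl
  iter-* {L} {a} (ℕ.suc q) per = begin
    iter σ (L + q * L) a        ≡⟨ iter-+ L (q * L) a ⟩
    iter σ L (iter σ (q * L) a) ≡⟨ cong (iter σ L) (iter-* q per) ⟩
    iter σ L a                  ≡⟨ per ⟩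
    a                           ∎
    where open ≡-Reasoning

  iter-% : ∀ {L a} .{{_ : NonZero L}} k → iter σ L a ≡ a → iter σ k a ≡ iter σ (k % L) a
  iter-% {L} {a} k per = begin
    iter σ k a                            ≡⟨ cong (λ m → iter σ m a) (m≡m%n+[m/n]*n k L) ⟩
    iter σ (k % L + k / L * L) a          ≡⟨ iter-+ (k % L) (k / L * L) a ⟩
    iter σ (k % L) (iter σ (k / L * L) a) ≡⟨ cong (iter σ (k % L)) (iter-* (k / L) per) ⟩
    iter σ (k % L) a                      ∎
    where open ≡-Reasoning

  iter-∸ : ∀ {i j a} → i ℕ.< j → iter σ i a ≡ iter σ j a → iter σ (j ∸ i) a ≡ a
  iter-∸ {i} {j} {a} i<j e = iter-injective i (begin
    iter σ i (iter σ (j ∸ i) a) ≡⟨ iter-+ i (j ∸ i) a ⟨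
    iter σ (i + (j ∸ i)) a      ≡⟨ cong (λ m → iter σ m a) (ℕₚ.m+[n∸m]≡n (ℕₚ.<⇒≤ i<j)) ⟩
    iter σ j a                  ≡⟨ e ⟨
    iter σ i a                  ∎)
    where open ≡-Reasoning

  bounded-period : ∀ a → ∃ λ P → 1 ≤ P × P ≤ n × iter σ P a ≡ a
  bounded-period a with pigeonhole (ℕₚ.n<1+n n) (λ (k : Fin (ℕ.suc n)) → iter σ (toℕ k) a)
  ... | i , j , i<j , e =
    toℕ j ∸ toℕ i , ℕₚ.m<n⇒0<n∸m i<j ,
    ℕₚ.≤-trans (ℕₚ.m∸n≤m (toℕ j) (toℕ i)) (ℕₚ.≤-pred (toℕ<n j)) , iter-∸ i<j e

  record LeastPeriod (a : Fin n) (L : ℕ) : Set where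
    field
      positive : 1 ≤ L
      periodic : iter σ L a ≡ a
      minimal  : ∀ {k} → 1 ≤ k → k ℕ.< L → iter σ k a ≢ a
  open LeastPeriod public

  leastPeriod-unique : ∀ {a L M} → LeastPeriod a L → LeastPeriod a M → L ≡ M
  leastPeriod-unique {L = L} {M} p q with ℕₚ.<-cmp L M
  ... | tri< L<M _ _ = ⊥-elim (minimal q (positive p) L<M (periodic p))
  ... | tri≈ _ L≡M _ = L≡M
  ... | tri> _ _ M<L = ⊥-elim (minimal p (positive q) M<L (periodic q))

  iter-injective-below : ∀ {a L i j} → LeastPeriod a L → i ℕ.< L → j ℕ.< L →
                         iter σ i a ≡ iter σ j a → i ≡ j
  iter-injective-below {i = i} {j} p i<L j<L e with ℕₚ.<-cmp i j
  ... | tri< i<j _ _ = ⊥-elim (minimal p (ℕₚ.m<n⇒0<n∸m i<j)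
                          (ℕₚ.≤-<-trans (ℕₚ.m∸n≤m j i) j<L) (iter-∸ i<j e))
  ... | tri≈ _ i≡j _ = i≡j
  ... | tri> _ _ j<i = ⊥-elim (minimal p (ℕₚ.m<n⇒0<n∸m j<i)
                          (ℕₚ.≤-<-trans (ℕₚ.m∸n≤m i j) i<L) (iter-∸ j<i (sym e)))

  cycleLenFrom-leastPeriod : ∀ a fuel k → 1 ≤ k → (∀ {j} → 1 ≤ j → j ℕ.< k → iter σ j a ≢ a) →
                             ∀ {P} → k ≤ P → P ℕ.< k + fuel → iter σ P a ≡ a →
                             LeastPeriod a (cycleLenFrom σ a k fuel)
  cycleLenFrom-leastPeriod a ℕ.zero k _ _ k≤P P<k+0 _ =
    ⊥-elim (ℕₚ.<⇒≱ P<k+0 (subst (_≤ _) (sym (ℕₚ.+-identityʳ k)) k≤P))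
  cycleLenFrom-leastPeriod a (ℕ.suc fuel) k k≥1 below {P} k≤P P< per with iter σ k a Finₚ.≟ a
  ... | yes k-periodic = record { positive = k≥1 ; periodic = k-periodic ; minimal = below }
  ... | no k-aperiodic = cycleLenFrom-leastPeriod a fuel (ℕ.suc k) (s≤s z≤n) below′ k<P
                           (subst (P ℕ.<_) (ℕₚ.+-suc k fuel) P<) per
    where
      below′ : ∀ {j} → 1 ≤ j → j ℕ.< ℕ.suc k → iter σ j a ≢ a
      below′ j≥1 j<1+k with ℕₚ.m≤n⇒m<n∨m≡n (ℕₚ.≤-pred j<1+k)
      ... | inj₁ j<k  = below j≥1 j<k
      ... | inj₂ refl = k-aperiodic
      k<P : k ℕ.< P
      k<P with ℕₚ.m≤n⇒m<n∨m≡n k≤P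
      ... | inj₁ k<P  = k<P
      ... | inj₂ refl = ⊥-elim (k-aperiodic per)

  cycleLen-leastPeriod : ∀ a → LeastPeriod a (cycleLen σ a)
  cycleLen-leastPeriod a with bounded-period a
  ... | P , P≥1 , P≤n , per = cycleLenFrom-leastPeriod a n 1 (s≤s z≤n)
                                (λ j≥1 j<1 → ⊥-elim (ℕₚ.<⇒≱ j<1 j≥1)) P≥1 (s≤s P≤n) per

  orbit : Fin n → (L : ℕ) → Fin L → Fin n
  orbit a L j = iter σ (toℕ j) a

  orbitList : Fin n → ℕ → List (Fin n)
  orbitList a L = tabulate (orbit a L)

  orbit-injective : ∀ {a L} → LeastPeriod a L → Injective _≡_ _≡_ (orbit a L)
  orbit-injective p {i} {j} e = toℕ-injective (iter-injective-below p (toℕ<n i) (toℕ<n j) e)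

  _∼_ : Fin n → Fin n → Set
  a ∼ b = ∃ λ j → iter σ j a ≡ b

  ∼-trans : ∀ {a b c} → a ∼ b → b ∼ c → a ∼ c
  ∼-trans {a} (j , refl) (k , refl) = k + j , iter-+ k j a

  ∼-sym : ∀ {a b} → a ∼ b → b ∼ a
  ∼-sym {a} (j , refl) with bounded-period a
  ... | ℕ.suc p , _ , _ , per = j * ℕ.suc p ∸ j , (begin
    iter σ (j * ℕ.suc p ∸ j) (iter σ j a) ≡⟨ iter-+ (j * ℕ.suc p ∸ j) j a ⟨
    iter σ (j * ℕ.suc p ∸ j + j) a        ≡⟨ cong (λ m → iter σ m a) (ℕₚ.m∸n+n≡m (ℕₚ.m≤m*n j (ℕ.suc p))) ⟩
    iter σ (j * ℕ.suc p) a                ≡⟨ iter-* j per ⟩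
    a                                     ∎)
    where open ≡-Reasoning

  ∈-orbit⁻ : ∀ {a L x} → x ∈ orbitList a L → a ∼ x
  ∈-orbit⁻ x∈ with ∈-tabulate⁻ x∈
  ... | j , refl = toℕ j , refl

  ∈-orbit⁺ : ∀ {a L x} → LeastPeriod a L → a ∼ x → x ∈ orbitList a L
  ∈-orbit⁺ {a} {ℕ.suc p} {x} per (j , refl) =
    subst (_∈ orbitList a (ℕ.suc p)) (sym reduce) (∈-tabulate⁺ {f = orbit a (ℕ.suc p)} (fromℕ< j%L<L))
    where
      j%L<L = m%n<n j (ℕ.suc p)
      reduce : iter σ j a ≡ orbit a (ℕ.suc p) (fromℕ< j%L<L)
      reduce = trans (iter-% j (periodic per)) (cong (λ m → iter σ m a) (sym (toℕ-fromℕ< j%L<L)))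

  leastPeriod-∼ : ∀ {a b L} → a ∼ b → LeastPeriod a L → LeastPeriod b L
  leastPeriod-∼ {a} {L = L} (j , refl) p = record
    { positive = positive p
    ; periodic = trans (iter-comm L j a) (cong (iter σ j) (periodic p))
    ; minimal  = λ {k} k≥1 k<L e → minimal p k≥1 k<L (iter-injective j (trans (iter-comm j k a) e))
    }

  CycleMinimum : Fin n → Set
  CycleMinimum m = ∀ {x} → m ∼ x → toℕ m ≤ toℕ x

  cycleMinimum-unique : ∀ {m m′} → CycleMinimum m → CycleMinimum m′ → m ∼ m′ → m ≡ m′
  cycleMinimum-unique min min′ m∼m′ = toℕ-injective (ℕₚ.≤-antisym (min m∼m′) (min′ (∼-sym m∼m′)))

  -- isCycleMin only inspects σᵏ(m) for k < n; every iterate is among these as the period is at most n.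
  isCycleMin⇔cycleMinimum : ∀ m → T (isCycleMin σ m) ⇔ CycleMinimum m
  isCycleMin⇔cycleMinimum m = mk⇔ to from
    where
      below : ℕ → Bool
      below k = toℕ m ≤ᵇ toℕ (iter σ k m)
      isCycleMin≡and : isCycleMin σ m ≡ foldr _∧_ true (map below (upTo n))
      isCycleMin≡and = sym (foldr-map _∧_ below true (upTo n))
      to : T (isCycleMin σ m) → CycleMinimum m
      to t (k , refl) with bounded-period m
      ... | ℕ.suc p , _ , P≤n , per =
        subst (λ x → toℕ m ≤ toℕ x) (sym (iter-% k per))
          (ℕₚ.≤ᵇ⇒≤ _ _ (All.lookup (all⁺ below (upTo n) (subst T isCycleMin≡and t))
                          (∈-upTo⁺ (ℕₚ.<-≤-trans (m%n<n k (ℕ.suc p)) P≤n))))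
      from : CycleMinimum m → T (isCycleMin σ m)
      from min = subst T (sym isCycleMin≡and) (all⁻ below {upTo n} (All.tabulate (λ {k} _ → ℕₚ.≤⇒≤ᵇ (min (k , refl)))))

  cycleMin : Fin n → Fin n
  cycleMin a = argmin toℕ a (orbitList a (cycleLen σ a))

  cycleMin-∼ : ∀ a → a ∼ cycleMin a
  cycleMin-∼ a with argmin-sel toℕ a (orbitList a (cycleLen σ a))
  ... | inj₁ min≡a = 0 , sym min≡a
  ... | inj₂ min∈  = ∈-orbit⁻ min∈

  cycleMin-minimum : ∀ a → CycleMinimum (cycleMin a)
  cycleMin-minimum a min∼x = All.lookup (f[argmin]≤f[xs] {f = toℕ} a (orbitList a (cycleLen σ a)))
    (∈-orbit⁺ (cycleLen-leastPeriod a) (∼-trans (cycleMin-∼ a) min∼x))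

  cycleMin-unique : ∀ {a m} → CycleMinimum m → a ∼ m → cycleMin a ≡ m
  cycleMin-unique {a} min a∼m = cycleMinimum-unique (cycleMin-minimum a) min (∼-trans (∼-sym (cycleMin-∼ a)) a∼m)

  cycleLen-cycleMin : ∀ {a L} → LeastPeriod a L → cycleLen σ (cycleMin a) ≡ L
  cycleLen-cycleMin {a} p = leastPeriod-unique (cycleLen-leastPeriod (cycleMin a)) (leastPeriod-∼ (cycleMin-∼ a) p)

  cycleMins : List (Fin n)
  cycleMins = filterᵇ (isCycleMin σ) (allFin n)

  cycleMins-unique : Unique cycleMins
  cycleMins-unique = Uniqueₚ.filter⁺ (T? ∘ isCycleMin σ) (Uniqueₚ.allFin⁺ n)

  ∈-cycleMins⁺ : ∀ {m} → CycleMinimum m → m ∈ cycleMins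
  ∈-cycleMins⁺ {m} min = ∈-filter⁺ (T? ∘ isCycleMin σ) (∈-allFin m) (Equivalence.from (isCycleMin⇔cycleMinimum m) min)

  ∈-cycleMins⁻ : ∀ {m} → m ∈ cycleMins → CycleMinimum m
  ∈-cycleMins⁻ {m} m∈ = Equivalence.to (isCycleMin⇔cycleMinimum m) (proj₂ (∈-filter⁻ (T? ∘ isCycleMin σ) {xs = allFin n} m∈))

  orbits : List (Fin n × ℕ) → List (Fin n)
  orbits = concatMap (uncurry orbitList)

  ∈-orbits⁺ : ∀ {A a L x} → (a , L) ∈ A → x ∈ orbitList a L → x ∈ orbits A
  ∈-orbits⁺ {(b , M) ∷ A} (here refl) x∈ = ∈-++⁺ˡ x∈
  ∈-orbits⁺ {(b , M) ∷ A} (there aL∈) x∈ = ∈-++⁺ʳ (orbitList b M) (∈-orbits⁺ aL∈ x∈)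

  ∈-orbits⁻ : ∀ A {x} → x ∈ orbits A → ∃₂ λ a L → (a , L) ∈ A × x ∈ orbitList a L
  ∈-orbits⁻ ((a , L) ∷ A) x∈ with ∈-++⁻ (orbitList a L) x∈
  ... | inj₁ x∈ₐ = a , L , here refl , x∈ₐ
  ... | inj₂ x∈A with ∈-orbits⁻ A x∈A
  ...   | b , M , bM∈ , x∈b = b , M , there bM∈ , x∈b

  record IsCycleDecomposition (A : List (Fin n × ℕ)) : Set where
    field
      leastPeriods : All (uncurry LeastPeriod) A
      disjoint     : Unique (orbits A)
      covering     : ∀ x → x ∈ orbits A
  open IsCycleDecomposition public

  Unique-map-cycleMin : ∀ A → All (uncurry LeastPeriod) A → Unique (orbits A) →
                          Unique (map (cycleMin ∘ proj₁) A)
  Unique-map-cycleMin [] [] _ = []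
  Unique-map-cycleMin ((a , L) ∷ A) (p ∷ ps) u with Unique-++⁻ (orbitList a L) u
  ... | _ , uA , a#A = All.tabulate distinct ∷ Unique-map-cycleMin A ps uA
    where
      distinct : ∀ {y} → y ∈ map (cycleMin ∘ proj₁) A → cycleMin a ≢ y
      distinct y∈ eq with ∈-map⁻ (cycleMin ∘ proj₁) y∈
      ... | (b , M) , bM∈ , refl = a#A (∈-orbit⁺ p (cycleMin-∼ a) ,
            ∈-orbits⁺ bM∈ (subst (_∈ orbitList b M) (sym eq) (∈-orbit⁺ (All.lookup ps bM∈) (cycleMin-∼ b))))

  map-cycleLen∘cycleMin : ∀ {A} → All (uncurry LeastPeriod) A → map (cycleLen σ ∘ cycleMin ∘ proj₁) A ≡ map proj₂ A
  map-cycleLen∘cycleMin []       = refl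
  map-cycleLen∘cycleMin (p ∷ ps) = cong₂ _∷_ (cycleLen-cycleMin p) (map-cycleLen∘cycleMin ps)

  cycleType↭lengths : ∀ {A} → IsCycleDecomposition A → cycleType σ ↭ map proj₂ A
  cycleType↭lengths {A} D = begin
    map (cycleLen σ) cycleMins                       ↭⟨ ↭ₚ.map⁺ (cycleLen σ) (↭-sym reps↭mins) ⟩
    map (cycleLen σ) (map (cycleMin ∘ proj₁) A)      ≡⟨ map-∘ A ⟨
    map (cycleLen σ ∘ cycleMin ∘ proj₁) A            ≡⟨ map-cycleLen∘cycleMin (leastPeriods D) ⟩
    map proj₂ A                                      ∎
    where
      open PermutationReasoning
      reps↭mins : map (cycleMin ∘ proj₁) A ↭ cycleMins
      reps↭mins = Unique-⇔⇒↭ (Unique-map-cycleMin A (leastPeriods D) (disjoint D)) cycleMins-unique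
        (λ y∈ → case ∈-map⁻ (cycleMin ∘ proj₁) y∈ of λ { ((a , _) , _ , refl) → ∈-cycleMins⁺ (cycleMin-minimum a) })
        (λ {m} m∈ → case ∈-orbits⁻ A (covering D m) of λ { (a , L , aL∈ , m∈a) →
          subst (_∈ map (cycleMin ∘ proj₁) A) (cycleMin-unique (∈-cycleMins⁻ m∈) (∈-orbit⁻ m∈a))
            (∈-map⁺ (cycleMin ∘ proj₁) aL∈) })

  withCycleLen : Fin n → Fin n × ℕ
  withCycleLen m = m , cycleLen σ m

  canonicalDecomposition : List (Fin n × ℕ)
  canonicalDecomposition = map withCycleLen cycleMins

  cycleType≡lengths-canonical : cycleType σ ≡ map proj₂ canonicalDecomposition
  cycleType≡lengths-canonical = map-∘ cycleMins

  Unique-orbits-cycleMinima : ∀ ms → Unique ms → All CycleMinimum ms → Unique (orbits (map withCycleLen ms))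
  Unique-orbits-cycleMinima []       []         []           = []
  Unique-orbits-cycleMinima (m ∷ ms) (m∉ ∷ u) (min ∷ mins) =
    Uniqueₚ.++⁺ (Uniqueₚ.tabulate⁺ (orbit-injective (cycleLen-leastPeriod m)))
                (Unique-orbits-cycleMinima ms u mins) m#ms
    where
      m#ms : Disjoint (orbitList m (cycleLen σ m)) (orbits (map withCycleLen ms))
      m#ms (x∈m , x∈ms) with ∈-orbits⁻ (map withCycleLen ms) x∈ms
      ... | _ , _ , m′L∈ , x∈m′ with ∈-map⁻ withCycleLen m′L∈
      ...   | m′ , m′∈ , refl = All.lookup m∉ m′∈ (cycleMinimum-unique min (All.lookup mins m′∈)
                                  (∼-trans (∈-orbit⁻ x∈m) (∼-sym (∈-orbit⁻ x∈m′))))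

  canonical-isCycleDecomposition : IsCycleDecomposition canonicalDecomposition
  canonical-isCycleDecomposition = record
    { leastPeriods = map⁺ (All.tabulate (λ {m} _ → cycleLen-leastPeriod m))
    ; disjoint     = Unique-orbits-cycleMinima cycleMins cycleMins-unique (All.tabulate ∈-cycleMins⁻)
    ; covering     = λ y → ∈-orbits⁺ (∈-map⁺ withCycleLen (∈-cycleMins⁺ (cycleMin-minimum y)))
                             (∈-orbit⁺ (cycleLen-leastPeriod (cycleMin y)) (∼-sym (cycleMin-∼ y)))
    }

  orbits-↭ : ∀ {A B} → A ↭ B → orbits A ↭ orbits B
  orbits-↭ ↭.refl                       = ↭-refl
  orbits-↭ (↭.prep (a , L) p)           = ↭ₚ.++⁺ˡ (orbitList a L) (orbits-↭ p)
  orbits-↭ (↭.swap (a , L) (b , M) p)   =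
    ↭-trans (↭ₚ.shifts (orbitList a L) (orbitList b M))
            (↭ₚ.++⁺ˡ (orbitList b M) (↭ₚ.++⁺ˡ (orbitList a L) (orbits-↭ p)))
  orbits-↭ (↭.trans p q)                = ↭-trans (orbits-↭ p) (orbits-↭ q)

  isCycleDecomposition-↭ : ∀ {A B} → A ↭ B → IsCycleDecomposition A → IsCycleDecomposition B
  isCycleDecomposition-↭ p D = record
    { leastPeriods = ↭ₚ.All-resp-↭ p (leastPeriods D)
    ; disjoint     = ↭ₛₚ.Unique-resp-↭ (setoid (Fin n)) (↭⇒↭ₛ (orbits-↭ p)) (disjoint D)
    ; covering     = λ x → ↭ₚ.∈-resp-↭ (orbits-↭ p) (covering D x)
    }

-- Realising a rotation of consecutive blocks

data Graph {n m : ℕ} (X : Fin m → Fin n) (t : Fin m → Fin m) : Fin n → Fin n → Set where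
  image   : ∀ i → Graph X t (X i) (X (t i))
  outside : ∀ {a} → (∀ i → X i ≢ a) → Graph X t a a

Realises : ∀ {n m} → Permutation′ n → (Fin m → Fin n) → (Fin m → Fin m) → Set
Realises σ X t = Injective _≡_ _≡_ X × (∀ {a c} → Graph X t a c → σ ⟨$⟩ʳ a ≡ c)

rotate : ∀ {ℓ} → Fin ℓ → Fin ℓ
rotate {ℕ.suc p} j = fromℕ< (m%n<n (ℕ.suc (toℕ j)) (ℕ.suc p))

toℕ-rotate : ∀ {p} (j : Fin (ℕ.suc p)) → toℕ (rotate j) ≡ ℕ.suc (toℕ j) % ℕ.suc p
toℕ-rotate {p} j = toℕ-fromℕ< (m%n<n (ℕ.suc (toℕ j)) (ℕ.suc p))

blockRotation : (λs : List ℕ) → Fin (sum λs) → Fin (sum λs)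
blockRotation []       ()
blockRotation (ℓ ∷ λs) = (λ j → rotate j ↑ˡ sum λs) V.++ (λ j → ℓ ↑ʳ blockRotation λs j)

module _ {n : ℕ} (σ : Permutation′ n) where

  orbit-rotate : ∀ {a L} → iter σ L a ≡ a → ∀ j → σ ⟨$⟩ʳ orbit σ a L j ≡ orbit σ a L (rotate j)
  orbit-rotate {a} {ℕ.suc p} per j =
    trans (iter-% σ {ℕ.suc p} {a} (ℕ.suc (toℕ j)) per) (cong (λ m → iter σ m a) (sym (toℕ-rotate j)))

  Rotates : (λs : List ℕ) → (Fin (sum λs) → Fin n) → Set
  Rotates λs X = ∀ i → σ ⟨$⟩ʳ X i ≡ X (blockRotation λs i)

  enumerate : (A : List (Fin n × ℕ)) → Fin (sum (map proj₂ A)) → Fin n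
  enumerate []             ()
  enumerate ((a , L) ∷ A) = orbit σ a L V.++ enumerate A

  orbits≡tabulate-enumerate : ∀ A → orbits σ A ≡ tabulate (enumerate A)
  orbits≡tabulate-enumerate []             = refl
  orbits≡tabulate-enumerate ((a , L) ∷ A) = begin
    orbitList σ a L ++ orbits σ A
      ≡⟨ cong (orbitList σ a L ++_) (orbits≡tabulate-enumerate A) ⟩
    orbitList σ a L ++ tabulate (enumerate A)
      ≡⟨ cong₂ _++_ (tabulate-cong (V.lookup-++ˡ (orbit σ a L) (enumerate A)))
                    (tabulate-cong (V.lookup-++ʳ (orbit σ a L) (enumerate A))) ⟨
    tabulate (X ∘ (_↑ˡ _)) ++ tabulate (X ∘ (L ↑ʳ_))
      ≡⟨ tabulate-split L X ⟨
    tabulate X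
      ∎
    where
      open ≡-Reasoning
      X = orbit σ a L V.++ enumerate A

  enumerate-rotates : ∀ {A} → All (uncurry (LeastPeriod σ)) A → Rotates (map proj₂ A) (enumerate A)
  -- V._++_ is defined by case analysis on splitAt.
  enumerate-rotates {(a , L) ∷ A} (p ∷ ps) i with splitAt L i
  ... | inj₁ j = trans (orbit-rotate (periodic p) j) (sym (V.lookup-++ˡ (orbit σ a L) (enumerate A) (rotate j)))
  ... | inj₂ j = trans (enumerate-rotates ps j)
                       (sym (V.lookup-++ʳ (orbit σ a L) (enumerate A) (blockRotation (map proj₂ A) j)))

  module _ {p} (Y : Fin (ℕ.suc p) → Fin n) (rotates : ∀ j → σ ⟨$⟩ʳ Y j ≡ Y (rotate j)) where

    iter-rotation : ∀ k (k<L : k ℕ.< ℕ.suc p) → iter σ k (Y zero) ≡ Y (fromℕ< k<L)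
    iter-rotation ℕ.zero    _   = refl
    iter-rotation (ℕ.suc k) k<L = begin
      σ ⟨$⟩ʳ iter σ k (Y zero) ≡⟨ cong (σ ⟨$⟩ʳ_) (iter-rotation k k<L′) ⟩
      σ ⟨$⟩ʳ Y (fromℕ< k<L′)   ≡⟨ rotates (fromℕ< k<L′) ⟩
      Y (rotate (fromℕ< k<L′)) ≡⟨ cong Y (toℕ-injective rotate-fromℕ<) ⟩
      Y (fromℕ< k<L)           ∎
      where
        open ≡-Reasoning
        k<L′ = ℕₚ.<-trans (ℕₚ.n<1+n k) k<L
        rotate-fromℕ< : toℕ (rotate (fromℕ< k<L′)) ≡ toℕ (fromℕ< k<L)
        rotate-fromℕ< = begin
          toℕ (rotate (fromℕ< k<L′))          ≡⟨ toℕ-rotate (fromℕ< k<L′) ⟩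
          ℕ.suc (toℕ (fromℕ< k<L′)) % ℕ.suc p ≡⟨ cong (λ m → ℕ.suc m % ℕ.suc p) (toℕ-fromℕ< k<L′) ⟩
          ℕ.suc k % ℕ.suc p                   ≡⟨ m<n⇒m%n≡m k<L ⟩
          ℕ.suc k                             ≡⟨ toℕ-fromℕ< k<L ⟨
          toℕ (fromℕ< k<L)                    ∎

    orbit-rotation : ∀ j → orbit σ (Y zero) (ℕ.suc p) j ≡ Y j
    orbit-rotation j = trans (iter-rotation (toℕ j) (toℕ<n j)) (cong Y (fromℕ<-toℕ j (toℕ<n j)))

    rotation-leastPeriod : Injective _≡_ _≡_ Y → LeastPeriod σ (Y zero) (ℕ.suc p)
    rotation-leastPeriod injective = record
      { positive = s≤s z≤n
      ; periodic = begin
          σ ⟨$⟩ʳ iter σ p (Y zero) ≡⟨ cong (σ ⟨$⟩ʳ_) (iter-rotation p p<L) ⟩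
          σ ⟨$⟩ʳ Y (fromℕ< p<L)    ≡⟨ rotates (fromℕ< p<L) ⟩
          Y (rotate (fromℕ< p<L))  ≡⟨ cong Y (toℕ-injective wraps) ⟩
          Y zero                   ∎
      ; minimal  = λ {k} k≥1 k<L e →
          ℕₚ.<⇒≢ k≥1 (sym (trans (sym (toℕ-fromℕ< k<L)) (cong toℕ (injective (trans (sym (iter-rotation k k<L)) e)))))
      }
      where
        open ≡-Reasoning
        p<L = ℕₚ.n<1+n p
        wraps : toℕ (rotate (fromℕ< p<L)) ≡ 0
        wraps = begin
          toℕ (rotate (fromℕ< p<L))          ≡⟨ toℕ-rotate (fromℕ< p<L) ⟩
          ℕ.suc (toℕ (fromℕ< p<L)) % ℕ.suc p ≡⟨ cong (λ m → ℕ.suc m % ℕ.suc p) (toℕ-fromℕ< p<L) ⟩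
          ℕ.suc p % ℕ.suc p                  ≡⟨ n%n≡0 (ℕ.suc p) ⟩
          0                                  ∎

  blocks : (λs : List ℕ) → All (1 ≤_) λs → (Fin (sum λs) → Fin n) → List (Fin n × ℕ)
  blocks []               []       X = []
  blocks (ℕ.suc p ∷ λs) (_ ∷ ps) X = (X (zero ↑ˡ sum λs) , ℕ.suc p) ∷ blocks λs ps (X ∘ (ℕ.suc p ↑ʳ_))

  blocks-lengths : ∀ λs ps X → map proj₂ (blocks λs ps X) ≡ λs
  blocks-lengths []               []       X = refl
  blocks-lengths (ℕ.suc p ∷ λs) (_ ∷ ps) X = cong (ℕ.suc p ∷_) (blocks-lengths λs ps (X ∘ (ℕ.suc p ↑ʳ_)))

  rotates-↑ˡ : ∀ {ℓ λs X} → Rotates (ℓ ∷ λs) X → ∀ j → σ ⟨$⟩ʳ X (j ↑ˡ sum λs) ≡ X (rotate j ↑ˡ sum λs)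
  rotates-↑ˡ {ℓ} {λs} {X} rot j =
    trans (rot (j ↑ˡ sum λs)) (cong X (V.lookup-++ˡ (λ j → rotate j ↑ˡ sum λs) (λ j → ℓ ↑ʳ blockRotation λs j) j))

  rotates-↑ʳ : ∀ {ℓ λs X} → Rotates (ℓ ∷ λs) X → Rotates λs (X ∘ (ℓ ↑ʳ_))
  rotates-↑ʳ {ℓ} {λs} {X} rot j =
    trans (rot (ℓ ↑ʳ j)) (cong X (V.lookup-++ʳ (λ j → rotate j ↑ˡ sum λs) (λ j → ℓ ↑ʳ blockRotation λs j) j))

  orbits-blocks : ∀ λs ps X → Rotates λs X → orbits σ (blocks λs ps X) ≡ tabulate X
  orbits-blocks []               []       X rot = refl
  orbits-blocks (ℕ.suc p ∷ λs) (_ ∷ ps) X rot = begin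
    orbitList σ (X (zero ↑ˡ sum λs)) (ℕ.suc p) ++ orbits σ (blocks λs ps (X ∘ (ℕ.suc p ↑ʳ_)))
      ≡⟨ cong₂ _++_ (tabulate-cong (orbit-rotation (X ∘ (_↑ˡ sum λs)) (rotates-↑ˡ {λs = λs} rot)))
                    (orbits-blocks λs ps (X ∘ (ℕ.suc p ↑ʳ_)) (rotates-↑ʳ {λs = λs} rot)) ⟩
    tabulate (X ∘ (_↑ˡ sum λs)) ++ tabulate (X ∘ (ℕ.suc p ↑ʳ_))
      ≡⟨ tabulate-split (ℕ.suc p) X ⟨
    tabulate X
      ∎
    where open ≡-Reasoning

  blocks-leastPeriods : ∀ λs ps X → Injective _≡_ _≡_ X → Rotates λs X → All (uncurry (LeastPeriod σ)) (blocks λs ps X)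
  blocks-leastPeriods []               []       X inj rot = []
  blocks-leastPeriods (ℕ.suc p ∷ λs) (_ ∷ ps) X inj rot =
    rotation-leastPeriod (X ∘ (_↑ˡ sum λs)) (rotates-↑ˡ {λs = λs} rot) (Finₚ.↑ˡ-injective (sum λs) _ _ ∘ inj) ∷
    blocks-leastPeriods λs ps (X ∘ (ℕ.suc p ↑ʳ_)) (Finₚ.↑ʳ-injective (ℕ.suc p) _ _ ∘ inj) (rotates-↑ʳ {λs = λs} rot)

  orbits-++ : ∀ A B → orbits σ (A ++ B) ≡ orbits σ A ++ orbits σ B
  orbits-++ = concatMap-++ (uncurry (orbitList σ))

  fixedPoint-leastPeriod : ∀ {y} → σ ⟨$⟩ʳ y ≡ y → LeastPeriod σ y 1
  fixedPoint-leastPeriod fixed = record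
    { positive = s≤s z≤n ; periodic = fixed ; minimal = λ k≥1 k<1 → ⊥-elim (ℕₚ.<⇒≱ k<1 k≥1) }

  orbits-fixedPoints : ∀ ys → orbits σ (map (_, 1) ys) ≡ ys
  orbits-fixedPoints []       = refl
  orbits-fixedPoints (y ∷ ys) = cong (y ∷_) (orbits-fixedPoints ys)

  lengths-fixedPoints : ∀ (ys : List (Fin n)) → map proj₂ (map (_, 1) ys) ≡ replicate (length ys) 1
  lengths-fixedPoints []       = refl
  lengths-fixedPoints (y ∷ ys) = cong (1 ∷_) (lengths-fixedPoints ys)

  realises⇒isCycleDecomposition : ∀ λs ps {X} → Realises σ X (blockRotation λs) →
                                  IsCycleDecomposition σ (blocks λs ps X ++ map (_, 1) (outsideImage X))
  realises⇒isCycleDecomposition λs ps {X} (injective , acts) = record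
    { leastPeriods = ++⁺ (blocks-leastPeriods λs ps X injective (acts ∘ image))
                         (map⁺ (All.tabulate (λ y∈ → fixedPoint-leastPeriod (acts (outside (∈-outsideImage⁻ y∈))))))
    ; disjoint     = subst Unique (sym orbits≡) (Unique-tabulate++outsideImage injective)
    ; covering     = λ y → subst (y ∈_) (sym orbits≡) (∈-tabulate++outsideImage y)
    }
    where
      orbits≡ : orbits σ (blocks λs ps X ++ map (_, 1) (outsideImage X)) ≡ tabulate X ++ outsideImage X
      orbits≡ = trans (orbits-++ (blocks λs ps X) (map (_, 1) (outsideImage X)))
                      (cong₂ _++_ (orbits-blocks λs ps X (acts ∘ image)) (orbits-fixedPoints (outsideImage X)))

  realises⇒cycleType : ∀ λs → All (1 ≤_) λs → ∀ {X} → Realises σ X (blockRotation λs) →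
                       ∃ λ k → cycleType σ ↭ λs ++ replicate k 1
  realises⇒cycleType λs ps {X} r = length (outsideImage X) , (begin
    cycleType σ
      ↭⟨ cycleType↭lengths σ (realises⇒isCycleDecomposition λs ps r) ⟩
    map proj₂ (blocks λs ps X ++ map (_, 1) (outsideImage X))
      ≡⟨ map-++ proj₂ (blocks λs ps X) (map (_, 1) (outsideImage X)) ⟩
    map proj₂ (blocks λs ps X) ++ map proj₂ (map (_, 1) (outsideImage X))
      ≡⟨ cong₂ _++_ (blocks-lengths λs ps X) (lengths-fixedPoints (outsideImage X)) ⟩
    λs ++ replicate (length (outsideImage X)) 1
      ∎)
    where open PermutationReasoning

  decomposition⇒realises : ∀ {A B} → IsCycleDecomposition σ (A ++ B) → All (λ c → proj₂ c ≡ 1) B →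
                           Realises σ (enumerate A) (blockRotation (map proj₂ A))
  decomposition⇒realises {A} {B} D fixedB = Unique-tabulate⁻ uniqueA , acts
    where
      uniqueA : Unique (tabulate (enumerate A))
      uniqueA = subst Unique (orbits≡tabulate-enumerate A)
                  (proj₁ (Unique-++⁻ (orbits σ A) (subst Unique (orbits-++ A B) (disjoint D))))
      fixed : ∀ {b M y} → (b , M) ∈ B → y ∈ orbitList σ b M → σ ⟨$⟩ʳ y ≡ y
      fixed bM∈ y∈ with All.lookup fixedB bM∈ | y∈
      ... | refl | here refl = periodic (All.lookup (++⁻ʳ A (leastPeriods D)) bM∈)
      acts : ∀ {a c} → Graph (enumerate A) (blockRotation (map proj₂ A)) a c → σ ⟨$⟩ʳ a ≡ c
      acts (image i) = enumerate-rotates (++⁻ˡ A (leastPeriods D)) i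
      acts (outside {y} ∉image) with ∈-++⁻ (orbits σ A) (subst (y ∈_) (orbits-++ A B) (covering D y))
      ... | inj₁ y∈A with ∈-tabulate⁻ (subst (y ∈_) (orbits≡tabulate-enumerate A) y∈A)
      ...   | i , e = ⊥-elim (∉image i (sym e))
      acts (outside {y} ∉image) | inj₂ y∈B with ∈-orbits⁻ σ B y∈B
      ...   | b , M , bM∈ , y∈b = fixed bM∈ y∈b

  realises⇔cycleType : ∀ λs → All (1 ≤_) λs →
                       (∃ λ X → Realises σ X (blockRotation λs)) ⇔ (∃ λ k → cycleType σ ↭ λs ++ replicate k 1)
  realises⇔cycleType λs ps = mk⇔ (λ (X , r) → realises⇒cycleType λs ps r) from
    where
      from : ∃ (λ k → cycleType σ ↭ λs ++ replicate k 1) → ∃ λ X → Realises σ X (blockRotation λs)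
      from (k , p) with ↭ₚ.↭-map-inv proj₂ (subst (_↭ λs ++ replicate k 1) (cycleType≡lengths-canonical σ) p)
      ... | D , lengths-D , canonical↭D with map-++⁻ proj₂ λs (replicate k 1) D (sym lengths-D)
      ...   | A , B , refl , refl , lengths-B =
              enumerate A , decomposition⇒realises
                              (isCycleDecomposition-↭ σ canonical↭D (canonical-isCycleDecomposition σ))
                              (map≡replicate⁻ proj₂ k B lengths-B)

-- The defining sentence

▸-cong : ∀ {n m} {ρ ρ′ : Fin m → Fin n} → (∀ i → ρ i ≡ ρ′ i) → ∀ a i → (ρ ▸ a) i ≡ (ρ′ ▸ a) i
▸-cong ρ≗ρ′ a zero    = refl
▸-cong ρ≗ρ′ a (suc i) = ρ≗ρ′ i

⊤f : ∀ {m} → Formula m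
⊤f = ¬f ⊥f

⋁ : ∀ {k m} → (Fin k → Formula m) → Formula m
⋁ {ℕ.zero}  φ = ⊥f
⋁ {ℕ.suc k} φ = φ zero ∨f ⋁ (φ ∘ suc)

⋀ : ∀ {k m} → (Fin k → Formula m) → Formula m
⋀ {ℕ.zero}  φ = ⊤f
⋀ {ℕ.suc k} φ = φ zero ∧f ⋀ (φ ∘ suc)

∃ⁿ : ∀ k → Formula k → Sentence
∃ⁿ ℕ.zero    φ = φ
∃ⁿ (ℕ.suc k) φ = ∃ⁿ k (∃f φ)

distinct : ∀ m → Formula m
distinct m = ⋀ λ i → ⋀ λ j → if does (i Finₚ.≟ j) then ⊤f else ¬f (i ≐ j)

graph : ∀ {k m} → (Fin m → Fin m) → (v w : Fin (k + m)) → Formula (k + m)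
graph {k} t v w = ⋁ (λ i → (v ≐ (k ↑ʳ i)) ∧f (w ≐ (k ↑ʳ t i))) ∨f ((v ≐ w) ∧f ⋀ (λ i → ¬f ((k ↑ʳ i) ≐ v)))

graphMonotone : ∀ {m} → (Fin m → Fin m) → Formula m
graphMonotone {m} t = ∀f (∀f (∀f (∀f (((graph {4} t a c ∧f graph {4} t b d) ∧f (a <V b)) ⇒f (c <P d)))))
  where
    a b c d : Fin (4 + m)
    a = # 3
    b = # 2
    c = # 1
    d = # 0

sentence : ∀ {m} → (Fin m → Fin m) → Sentence
sentence {m} t = ∃ⁿ m (distinct m ∧f graphMonotone t)

module _ {n : ℕ} (σ : Permutation′ n) where

  GraphMonotone : ∀ {m} → (Fin m → Fin n) → (Fin m → Fin m) → Set
  GraphMonotone X t = ∀ {a b c d} → Graph X t a c → Graph X t b d → σ ⟨$⟩ʳ a < σ ⟨$⟩ʳ b → c < d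

  module _ {m} {X : Fin m → Fin n} {t : Fin m → Fin m} where

    graph-total : ∀ a → ∃ (Graph X t a)
    graph-total a with any? (λ i → X i Finₚ.≟ a)
    ... | yes (i , refl) = X (t i) , image i
    ... | no  ∉image      = a , outside (λ i e → ∉image (i , e))

    graph-functional : Injective _≡_ _≡_ X → ∀ {a a′ c c′} → Graph X t a c → Graph X t a′ c′ → a ≡ a′ → c ≡ c′
    graph-functional injective (image i)        (image j)        e = cong (X ∘ t) (injective e)
    graph-functional injective (image i)        (outside ∉image) e = ⊥-elim (∉image i e)
    graph-functional injective (outside ∉image) (image j)        e = ⊥-elim (∉image j (sym e))
    graph-functional injective (outside _)      (outside _)      e = e

    realises⇔graphMonotone : Realises σ X t ⇔ (Injective _≡_ _≡_ X × GraphMonotone X t)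
    realises⇔graphMonotone = mk⇔
      (λ (injective , acts) → injective , λ a↦c b↦d → subst₂ _<_ (acts a↦c) (acts b↦d))
      (λ (injective , monotone) → injective , acts injective monotone)
      where
        acts : Injective _≡_ _≡_ X → GraphMonotone X t → ∀ {a c} → Graph X t a c → σ ⟨$⟩ʳ a ≡ c
        acts injective monotone {a} a↦c = trans σa≡fa (graph-functional injective (proj₂ (graph-total a)) a↦c refl)
          where
            f : Fin n → Fin n
            f = proj₁ ∘ graph-total
            f∘σ⁻¹-increasing : ∀ {c d} → c < d → f (σ ⟨$⟩ˡ c) < f (σ ⟨$⟩ˡ d)
            f∘σ⁻¹-increasing c<d = monotone (proj₂ (graph-total _)) (proj₂ (graph-total _))
                                     (subst₂ _<_ (sym (inverseʳ σ)) (sym (inverseʳ σ)) c<d)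
            σa≡fa : σ ⟨$⟩ʳ a ≡ f a
            σa≡fa = trans (sym (increasing⇒≗id (f ∘ (σ ⟨$⟩ˡ_)) f∘σ⁻¹-increasing (σ ⟨$⟩ʳ a))) (cong f (inverseˡ σ))

  ⟦⟧-cong : ∀ {m} (φ : Formula m) {ρ ρ′ : Fin m → Fin n} → (∀ i → ρ i ≡ ρ′ i) → ⟦ φ ⟧ σ ρ → ⟦ φ ⟧ σ ρ′
  ⟦⟧-cong (x <P y)   ρ≗ρ′ h         = subst₂ _<_ (ρ≗ρ′ x) (ρ≗ρ′ y) h
  ⟦⟧-cong (x <V y)   ρ≗ρ′ h         = subst₂ (λ u v → σ ⟨$⟩ʳ u < σ ⟨$⟩ʳ v) (ρ≗ρ′ x) (ρ≗ρ′ y) h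
  ⟦⟧-cong (x ≐ y)    ρ≗ρ′ h         = trans (sym (ρ≗ρ′ x)) (trans h (ρ≗ρ′ y))
  ⟦⟧-cong ⊥f         ρ≗ρ′ ()
  ⟦⟧-cong (¬f φ)     ρ≗ρ′ h         = h ∘ ⟦⟧-cong φ (sym ∘ ρ≗ρ′)
  ⟦⟧-cong (φ ∧f ψ)   ρ≗ρ′ (h₁ , h₂) = ⟦⟧-cong φ ρ≗ρ′ h₁ , ⟦⟧-cong ψ ρ≗ρ′ h₂
  ⟦⟧-cong (φ ∨f ψ)   ρ≗ρ′ (inj₁ h)  = inj₁ (⟦⟧-cong φ ρ≗ρ′ h)
  ⟦⟧-cong (φ ∨f ψ)   ρ≗ρ′ (inj₂ h)  = inj₂ (⟦⟧-cong ψ ρ≗ρ′ h)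
  ⟦⟧-cong (φ ⇒f ψ)   ρ≗ρ′ h         = ⟦⟧-cong ψ ρ≗ρ′ ∘ h ∘ ⟦⟧-cong φ (sym ∘ ρ≗ρ′)
  ⟦⟧-cong (∀f φ)     ρ≗ρ′ h         = λ a → ⟦⟧-cong φ (▸-cong ρ≗ρ′ a) (h a)
  ⟦⟧-cong (∃f φ)     ρ≗ρ′ (a , h)   = a , ⟦⟧-cong φ (▸-cong ρ≗ρ′ a) h

  ⟦⋁⟧ : ∀ {k m} (φ : Fin k → Formula m) ρ → ⟦ ⋁ φ ⟧ σ ρ ⇔ ∃ λ i → ⟦ φ i ⟧ σ ρ
  ⟦⋁⟧ {ℕ.zero}  φ ρ = mk⇔ (λ ()) (λ ())
  ⟦⋁⟧ {ℕ.suc k} φ ρ = mk⇔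
    (λ { (inj₁ h) → zero , h ; (inj₂ h) → let i , h′ = Equivalence.to (⟦⋁⟧ (φ ∘ suc) ρ) h in suc i , h′ })
    (λ { (zero , h) → inj₁ h ; (suc i , h) → inj₂ (Equivalence.from (⟦⋁⟧ (φ ∘ suc) ρ) (i , h)) })

  ⟦⋀⟧ : ∀ {k m} (φ : Fin k → Formula m) ρ → ⟦ ⋀ φ ⟧ σ ρ ⇔ (∀ i → ⟦ φ i ⟧ σ ρ)
  ⟦⋀⟧ {ℕ.zero}  φ ρ = mk⇔ (λ _ ()) (λ _ ())
  ⟦⋀⟧ {ℕ.suc k} φ ρ = mk⇔
    (λ { (h , _) zero → h ; (_ , h) (suc i) → Equivalence.to (⟦⋀⟧ (φ ∘ suc) ρ) h i })
    (λ h → h zero , Equivalence.from (⟦⋀⟧ (φ ∘ suc) ρ) (h ∘ suc))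

  ⟦∃ⁿ⟧ : ∀ k (φ : Formula k) ρ → ⟦ ∃ⁿ k φ ⟧ σ ρ ⇔ ∃ λ X → ⟦ φ ⟧ σ X
  ⟦∃ⁿ⟧ ℕ.zero    φ ρ = mk⇔ (ρ ,_) (λ (X , h) → ⟦⟧-cong φ (λ ()) h)
  ⟦∃ⁿ⟧ (ℕ.suc k) φ ρ = mk⇔
    (λ h → let X , a , h′ = Equivalence.to (⟦∃ⁿ⟧ k (∃f φ) ρ) h in X ▸ a , h′)
    (λ (X , h) → Equivalence.from (⟦∃ⁿ⟧ k (∃f φ) ρ) (X ∘ suc , X zero , ⟦⟧-cong φ (λ { zero → refl ; (suc i) → refl }) h))

  ⟦distinct⟧ : ∀ m (ρ : Fin m → Fin n) → ⟦ distinct m ⟧ σ ρ ⇔ Injective _≡_ _≡_ ρ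
  ⟦distinct⟧ m ρ = mk⇔ to from
    where
      to : ⟦ distinct m ⟧ σ ρ → Injective _≡_ _≡_ ρ
      to h {i} {j} e with i Finₚ.≟ j | Equivalence.to (⟦⋀⟧ _ ρ) (Equivalence.to (⟦⋀⟧ _ ρ) h i) j
      ... | yes i≡j | _   = i≡j
      ... | no  _   | ρi≢ρj = ⊥-elim (ρi≢ρj e)
      from : Injective _≡_ _≡_ ρ → ⟦ distinct m ⟧ σ ρ
      from injective = Equivalence.from (⟦⋀⟧ _ ρ) λ i → Equivalence.from (⟦⋀⟧ _ ρ) λ j → differ i j
        where
          differ : ∀ i j → ⟦ if does (i Finₚ.≟ j) then ⊤f else ¬f (i ≐ j) ⟧ σ ρ
          differ i j with i Finₚ.≟ j
          ... | yes _   = λ ()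
          ... | no  i≢j = i≢j ∘ injective

  module _ {k m} (t : Fin m → Fin m) (v w : Fin (k + m)) (ρ : Fin (k + m) → Fin n) where

    graph⁺ : ∀ {a c} → Graph (ρ ∘ (k ↑ʳ_)) t a c → ρ v ≡ a → ρ w ≡ c → ⟦ graph t v w ⟧ σ ρ
    graph⁺ (image i)        e₁ e₂ = inj₁ (Equivalence.from (⟦⋁⟧ _ ρ) (i , e₁ , e₂))
    graph⁺ (outside ∉image) e₁ e₂ = inj₂ (trans e₁ (sym e₂) , Equivalence.from (⟦⋀⟧ _ ρ) (λ i e → ∉image i (trans e e₁)))

    ⟦graph⟧ : ⟦ graph t v w ⟧ σ ρ ⇔ Graph (ρ ∘ (k ↑ʳ_)) t (ρ v) (ρ w)
    ⟦graph⟧ = mk⇔ to (λ g → graph⁺ g refl refl)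
      where
        to : ⟦ graph t v w ⟧ σ ρ → Graph (ρ ∘ (k ↑ʳ_)) t (ρ v) (ρ w)
        to (inj₁ h) with Equivalence.to (⟦⋁⟧ _ ρ) h
        ... | i , e₁ , e₂ = subst₂ (Graph (ρ ∘ (k ↑ʳ_)) t) (sym e₁) (sym e₂) (image i)
        to (inj₂ (e , h)) = subst (Graph (ρ ∘ (k ↑ʳ_)) t (ρ v)) e (outside (Equivalence.to (⟦⋀⟧ _ ρ) h))

  ⟦sentence⟧ : ∀ {m} (t : Fin m → Fin m) → σ ⊨ sentence t ⇔ ∃ λ X → Injective _≡_ _≡_ X × GraphMonotone X t
  ⟦sentence⟧ {m} t = mk⇔
    (λ h → let X , body = Equivalence.to (⟦∃ⁿ⟧ m (distinct m ∧f graphMonotone t) (λ ())) h in X , body⇒ X body)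
    (λ (X , injective , monotone) → Equivalence.from (⟦∃ⁿ⟧ m (distinct m ∧f graphMonotone t) (λ ())) (X , ⇒body X injective monotone))
    where
      body⇒ : ∀ X → ⟦ distinct m ∧f graphMonotone t ⟧ σ X → Injective _≡_ _≡_ X × GraphMonotone X t
      body⇒ X (dist , h) = Equivalence.to (⟦distinct⟧ m X) dist ,
        λ {a} {b} {c} {d} a↦c b↦d σa<σb → h a b c d
          ((Equivalence.from (⟦graph⟧ t _ _ _) a↦c , Equivalence.from (⟦graph⟧ t _ _ _) b↦d) , σa<σb)
      ⇒body : ∀ X → Injective _≡_ _≡_ X → GraphMonotone X t → ⟦ distinct m ∧f graphMonotone t ⟧ σ X
      ⇒body X injective monotone = Equivalence.from (⟦distinct⟧ m X) injective ,
        λ a b c d ((a↦c , b↦d) , σa<σb) →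
          monotone (Equivalence.to (⟦graph⟧ t _ _ _) a↦c) (Equivalence.to (⟦graph⟧ t _ _ _) b↦d) σa<σb

  ⊨sentence⇔realisable : ∀ {m} (t : Fin m → Fin m) → σ ⊨ sentence t ⇔ ∃ λ X → Realises σ X t
  ⊨sentence⇔realisable t = ⇔.trans (⟦sentence⟧ t)
    (mk⇔ (λ (X , h) → X , Equivalence.from realises⇔graphMonotone h) (λ (X , r) → X , Equivalence.to realises⇔graphMonotone r))

proposition3p19 : (λ′ : List ℕ) → All (1 ≤_) λ′ →
    Σ Sentence (λ φ → (n : ℕ) (σ : Permutation′ n) →
      (σ ⊨ φ) ⇔ ∃ (λ k → cycleType σ ↭ (λ′ ++ replicate k 1)))
proposition3p19 λ′ ps = sentence (blockRotation λ′) , λ n σ →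
  ⇔.trans (⊨sentence⇔realisable σ (blockRotation λ′)) (realises⇔cycleType σ λ′ ps)
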